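{- Let $n\ge1$. Let $\{H_1,H_2,H_3\}$ be a Latin Hamilton decomposition of $G_{n,3}$ and $\{E_1,\dots,E_n\}$ a Latin Hamilton decomposition of $Q_{2n}$. Then the Hamilton decomposition $\{g(E_i,H_j): 1\le i\le n,\ 1\le j\le 3\}$ of $Q_{6n}$ is Latin.
   Context: $G_{n,k}$ is the Cartesian product of $k$ copies of $C_{4^n}$: vertices $(x_1,\dots,x_k)$, $x_i\in\mathbb{Z}/4^n\mathbb{Z}$, adjacent iff they differ in one coordinate by $\pm1$. $Q_{2m}$ is identified with $G_{1,m}$ (quaternary strings of length $m$, axes $1,\dots,m$). Edges in coordinate $i$ traversed from $x_i$ to $x_i+1$ are labelled $i$, the reverse $\overline i$. Directed Hamilton cycles start and end at the origin $\mathbf 0$ and are recorded as label sequences. A Hamilton decomposition (H.D.) of $G_{n,k}$ is a set of $k$ directed Hamilton cycles whose edge sets partition the edges. A permutation $\sigma$ of $\{1,\dots,k\}$ acts by $(x_1,\dots,x_k)\mapsto(x_{\sigma^{ -1}(1)},\dots,x_{\sigma^{ -1}(k)})$, sending a directed cycle $e_1\cdots e_N$ to $\sigma(e_1)\cdots\sigma(e_N)$ with $\sigma(\overline i)=\overline{\sigma(i)}$. A Latin family is $\{\sigma_1,\dots,\sigma_k\}$ with $\sigma_1=\mathrm{id}$ and $(\sigma_i(j))$ a Latin square; an H.D. $T$ is Latin if $T=\{\sigma_1(H),\dots,\sigma_k(H)\}$ for some directed Hamilton cycle $H$ and Latin family. Definition of $g$: for a directed Hamilton cycle $E$ of $Q_{2n}$,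 let $\varphi_E(u)=t$ if $u$ is the $t$-th vertex of $E$ (origin is the $0$-th), a bijection $V(Q_{2n})\to\mathbb{Z}/4^n\mathbb{Z}$. Identify $Q_{6n}=Q_{2n}\Box Q_{2n}\Box Q_{2n}$, a vertex $(u,v,w)$ having $u$ on axes $1,\dots,n$, $v$ on axes $n+1,\dots,2n$, $w$ on axes $2n+1,\dots,3n$. The map $(u,v,w)\mapsto(\varphi_E(u),\varphi_E(v),\varphi_E(w))$ is a bijection onto $V(G_{n,3})$ fixing the origin under which every edge of $G_{n,3}$ pulls back to an edge of $Q_{6n}$; for a directed Hamilton cycle $H$ of $G_{n,3}$, $g(E,H)$ is the directed Hamilton cycle of $Q_{6n}$ that is the preimage of $H$. -}

module Defs where

open import Data.Nat using (ℕ; zero; suc; _+_; _*_; _∸_; _^_; NonZero)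
open import Data.Nat.Properties using (m^n≢0)
open import Data.Nat.DivMod using (_mod_)
open import Data.Fin using (Fin; toℕ; combine; remQuot)
open import Data.Fin.Permutation using (Permutation′; _⟨$⟩ʳ_)
open import Data.Bool using (Bool; true; false; not)
open import Data.Vec using (Vec; replicate; updateAt; lookup)
open import Data.List using (List; []; _∷_; length; map; mapMaybe)
open import Data.List.Membership.Propositional using (_∈_)
open import Data.List.Relation.Unary.Unique.Propositional using (Unique)
open import Data.Maybe using (Maybe; just; nothing)
open import Data.Product using (Σ; ∃; _×_; _,_)
open import Relation.Binary.PropositionalEquality using (_≡_)

-- The torus  C_m □ ... □ C_m  (k factors).  G_{n,k} = Torus (4^n) k,
-- Q_{2m} = G_{1,m} = Torus 4 m.

4^n-nonZero : ∀ n → NonZero (4 ^ n)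
4^n-nonZero n = m^n≢0 4 n

Vertex : ℕ → ℕ → Set
Vertex m k = Vec (Fin m) k

origin : (m k : ℕ) .{{_ : NonZero m}} → Vertex m k
origin m k = replicate k (0 mod m)

sucMod : ∀ {m} → Fin m → Fin m
sucMod {suc m} x = suc (toℕ x) mod suc m

predMod : ∀ {m} → Fin m → Fin m
predMod {suc m} x = (toℕ x + m) mod suc m

-- edge labels: (i , true) is the label i, (i , false) is the label \bar i
Label : ℕ → Set
Label k = Fin k × Bool

step : ∀ {m k} → Label k → Vertex m k → Vertex m k
step (i , true)  v = updateAt v i sucMod
step (i , false) v = updateAt v i predMod

endVertex : ∀ {m k} → Vertex m k → List (Label k) → Vertex m k
endVertex v []       = v
endVertex v (e ∷ es) = endVertex (step e v) es

visited : ∀ {m k} → Vertex m k → List (Label k) → List (Vertex m k)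
visited v []       = []
visited v (e ∷ es) = v ∷ visited (step e v) es

-- an undirected edge {v, v + e_i} is represented by the pair (v , i)
Edge : ℕ → ℕ → Set
Edge m k = Vertex m k × Fin k

edgeOf : ∀ {m k} → Vertex m k → Label k → Edge m k
edgeOf v (i , true)  = v , i
edgeOf v (i , false) = step (i , false) v , i

edgesFrom : ∀ {m k} → Vertex m k → List (Label k) → List (Edge m k)
edgesFrom v []       = []
edgesFrom v (e ∷ es) = edgeOf v e ∷ edgesFrom (step e v) es

-- directed Hamilton cycle starting and ending at the origin,
-- recorded as its label sequence
IsHamCycle : (m k : ℕ) .{{_ : NonZero m}} → List (Label k) → Set
IsHamCycle m k H =
  (length H ≡ m ^ k) ×
  Unique (visited (origin m k) H) ×
  (endVertex (origin m k) H ≡ origin m k)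

edges : (m k : ℕ) .{{_ : NonZero m}} → List (Label k) → List (Edge m k)
edges m k H = edgesFrom (origin m k) H

IsHD : (m k : ℕ) .{{_ : NonZero m}} → (Fin k → List (Label k)) → Set
IsHD m k T =
  (∀ j → IsHamCycle m k (T j)) ×
  (∀ (v : Vertex m k) (i : Fin k) →
     (∃ λ j → (v , i) ∈ edges m k (T j)) ×
     (∀ j j' → (v , i) ∈ edges m k (T j) → (v , i) ∈ edges m k (T j') → j ≡ j'))

actLabel : ∀ {k} → Permutation′ k → Label k → Label k
actLabel σ (i , d) = σ ⟨$⟩ʳ i , d

act : ∀ {k} → Permutation′ k → List (Label k) → List (Label k)
act σ H = map (actLabel σ) H

-- {σ_1,...,σ_k} with σ_1 = id and (σ_i(j)) a Latin square.
-- (Rows are permutations automatically; the Latin condition is that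
-- every column is injective.)  The family is indexed by Fin k and the
-- index playing the role of σ_1 is i₁.
IsLatinFamily : ∀ {k} → (Fin k → Permutation′ k) → Set
IsLatinFamily {k} σ =
  (∃ λ i₁ → ∀ x → σ i₁ ⟨$⟩ʳ x ≡ x) ×
  (∀ (j : Fin k) (i i' : Fin k) → σ i ⟨$⟩ʳ j ≡ σ i' ⟨$⟩ʳ j → i ≡ i')

IsLatinHD : (m k : ℕ) .{{_ : NonZero m}} → (Fin k → List (Label k)) → Set
IsLatinHD m k T =
  IsHD m k T ×
  Σ (List (Label k)) λ H → Σ (Fin k → Permutation′ k) λ σ →
    IsHamCycle m k H × IsLatinFamily σ ×
    (∀ j → ∃ λ i → T j ≡ act (σ i) H) ×
    (∀ i → ∃ λ j → act (σ i) H ≡ T j)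

labelAt : ∀ {k} → List (Label k) → ℕ → Maybe (Label k)
labelAt []       _       = nothing
labelAt (e ∷ es) zero    = just e
labelAt (e ∷ es) (suc t) = labelAt es t

-- put an axis l ∈ {1..n} of the c-th copy of Q_{2n} on axis c·n + l
-- of Q_{6n} = Q_{2n} □ Q_{2n} □ Q_{2n}
shift : ∀ {n} → Fin 3 → Label n → Label (3 * n)
shift c (l , d) = combine c l , d

-- the Q_{6n}-label of the preimage of the step of H taken at vertex p.
-- The edge a → a+1 of the c-th factor C_{4^n} is the preimage of the
-- a-th edge of E (from φ_E⁻¹(a) to φ_E⁻¹(a+1)); the edge a → a-1 is the
-- (a-1)-th edge of E traversed backwards.
gStep : ∀ {n} → List (Label n) → Vertex (4 ^ n) 3 → Label 3 → Maybe (Label (3 * n))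
gStep E p (c , true)  with labelAt E (toℕ (lookup p c))
... | just e  = just (shift c e)
... | nothing = nothing
gStep E p (c , false) with labelAt E (toℕ (predMod (lookup p c)))
... | just (l , d) = just (shift c (l , not d))
... | nothing      = nothing

gFrom : ∀ {n} → List (Label n) → Vertex (4 ^ n) 3 → List (Label 3) → List (Label (3 * n))
gFrom E p []       = []
gFrom E p (e ∷ es) with gStep E p e
... | just e' = e' ∷ gFrom E (step e p) es
... | nothing = gFrom E (step e p) es

-- g(E,H): the directed Hamilton cycle of Q_{6n} which is the preimage
-- of H under (u,v,w) ↦ (φ_E(u), φ_E(v), φ_E(w))
g : (n : ℕ) → List (Label n) → List (Label 3) → List (Label (3 * n))
g n E H = gFrom E (origin (4 ^ n) 3 {{4^n-nonZero n}}) H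

-- the family {g(E_i,H_j)} indexed by Fin (3 * n) via x ↦ (j , i)
gFamily : (n : ℕ) → (Fin n → List (Label n)) → (Fin 3 → List (Label 3)) →
          Fin (3 * n) → List (Label (3 * n))
gFamily n E H x with remQuot {3} n x
... | (j , i) = g n (E i) (H j)

IsLatinHD-G : (n k : ℕ) → (Fin k → List (Label k)) → Set
IsLatinHD-G n k T = IsLatinHD (4 ^ n) k {{4^n-nonZero n}} T

-- g(E,H) is the image of H under the embedding G_{n,3} → Q_{6n} that applies φ_E⁻¹ in each of
-- the three blocks of axes: a step of H in coordinate c from position a becomes the a-th step of E
-- on the axes of block c.  So g(E,H) is a Hamilton cycle, and its edges are the lifts of the edges
-- of H.  An edge of Q_{6n} in block c projects to an edge of Q_{2n}, which lies on exactly one E_i;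
-- the lift along E_i is injective (a Hamilton cycle of length ≥ 3 never runs along an edge and
-- straight back) and onto the edges with that projection, and the preimage lies on exactly one
-- H_j.  Hence the g(E_i,H_j) partition the edges.  Finally g(σE, ρH) = (ρ ⊗ σ) g(E,H), where ρ ⊗ σ
-- permutes the blocks by ρ and the axes inside every block by σ, and the products ρ_j ⊗ σ_i of two
-- Latin families again form a Latin family.

module Submission where

open import Defs
open import Data.Bool using (Bool; true; false; not)
open import Data.Bool.Properties using (not-involutive)
open import Data.Empty using (⊥-elim)
open import Data.Fin using (Fin; toℕ; cast; combine; remQuot; funToFin; finToFun; _↑ˡ_; _↑ʳ_)
  renaming (zero to fzero; suc to fsuc; _≟_ to _≟ᶠ_)
open import Data.Fin.Properties
  using (toℕ-fromℕ<; toℕ<n; toℕ-cast; toℕ-injective; any?; injective⇒≤; finToFun-funToFin;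
         remQuot-combine; combine-surjective; combine-injectiveˡ; combine-injectiveʳ)
open import Data.Fin.Permutation using (Permutation′; permutation; _⟨$⟩ʳ_; _⟨$⟩ˡ_; inverseˡ; inverseʳ)
open import Data.List using (List; []; _∷_; length)
import Data.List as List
open import Data.List.Membership.Propositional using (_∈_)
open import Data.List.Membership.Propositional.Properties using (∈-map⁺; ∈-map⁻)
open import Data.List.Relation.Unary.Any using (here; there)
import Data.List.Relation.Unary.All as All
open import Data.List.Relation.Unary.AllPairs using (_∷_)
open import Data.List.Relation.Unary.Unique.Propositional using (Unique)
open import Data.List.Relation.Unary.Unique.Propositional.Properties using (map⁺)
open import Data.Maybe using (just; nothing)
import Data.Maybe as Maybe
open import Data.Nat using (ℕ; zero; suc; _+_; _*_; _^_; _≤_; NonZero; z≤n; s≤s)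
open import Data.Nat.DivMod using (_mod_; _%_; n%n≡0; %-distribˡ-+; m%n%n≡m%n; [m+n]%n≡m%n; m<n⇒m%n≡m; m≡m%n+[m/n]*n; _/_)
open import Data.Nat.Properties using (^-monoʳ-≤; ^-*-assoc; *-comm; m^n≢0; m≤n⇒m<n∨m≡n; +-comm; +-suc; +-cancelˡ-≡; m≤m+n; ≤-trans; 1+n≰n)
open import Data.Sum using (_⊎_; inj₁; inj₂)
open import Data.Product using (∃; _×_; _,_; proj₁; proj₂; uncurry)
open import Data.Vec using (group; Vec; _∷_; []; _++_; concat; map; lookup; updateAt; tabulate; replicate)
open import Data.Vec.Properties
  using (lookup∘tabulate; tabulate∘lookup; tabulate-cong; lookup∘updateAt; lookup∘updateAt′;
         updateAt-updateAt; updateAt-id-local; updateAt-id; ≡-dec; ++-injectiveˡ; ++-injectiveʳ; lookup-replicate; lookup-concat; map-updateAt; map-replicate; lookup-map)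
open import Function using (_∘_)
open import Function.Definitions using (Injective)
open import Relation.Binary.Definitions using (DecidableEquality)
open import Relation.Binary.PropositionalEquality
open import Relation.Nullary using (yes; no)

open ≡-Reasoning

private variable
  A : Set
  m n k : ℕ

-- Arithmetic in ℤ/mℤ

[m+n%d]%d≡[m+n]%d : ∀ m n d .{{_ : NonZero d}} → (m + n % d) % d ≡ (m + n) % d
[m+n%d]%d≡[m+n]%d m n d = begin
  (m + n % d) % d         ≡⟨ %-distribˡ-+ m (n % d) d ⟩
  (m % d + n % d % d) % d ≡⟨ cong (λ x → (m % d + x) % d) (m%n%n≡m%n n d) ⟩
  (m % d + n % d) % d     ≡⟨ %-distribˡ-+ m n d ⟨
  (m + n) % d             ∎

[i+n]%n≡i : (i : Fin (suc n)) → (toℕ i + suc n) % suc n ≡ toℕ i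
[i+n]%n≡i {n} i = trans ([m+n]%n≡m%n (toℕ i) (suc n)) (m<n⇒m%n≡m (toℕ<n i))

toℕ-sucMod : .{{_ : NonZero n}} (i : Fin n) → toℕ (sucMod i) ≡ suc (toℕ i) % n
toℕ-sucMod {suc n} i = toℕ-fromℕ< _

toℕ-predMod : (i : Fin (suc n)) → toℕ (predMod i) ≡ (toℕ i + n) % suc n
toℕ-predMod i = toℕ-fromℕ< _

toℕ-0mod : ∀ m .{{_ : NonZero m}} → toℕ (0 mod m) ≡ 0
toℕ-0mod (suc m) = refl

sucMod-predMod : (i : Fin n) → sucMod (predMod i) ≡ i
sucMod-predMod {suc n} i = toℕ-injective (begin
  toℕ (sucMod (predMod i))            ≡⟨ toℕ-sucMod (predMod i) ⟩
  suc (toℕ (predMod i)) % suc n       ≡⟨ cong (λ x → suc x % suc n) (toℕ-predMod i) ⟩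
  (1 + (toℕ i + n) % suc n) % suc n   ≡⟨ [m+n%d]%d≡[m+n]%d 1 (toℕ i + n) (suc n) ⟩
  suc (toℕ i + n) % suc n             ≡⟨ cong (_% suc n) (+-suc (toℕ i) n) ⟨
  (toℕ i + suc n) % suc n             ≡⟨ [i+n]%n≡i i ⟩
  toℕ i                               ∎)

predMod-sucMod : (i : Fin n) → predMod (sucMod i) ≡ i
predMod-sucMod {suc n} i = toℕ-injective (begin
  toℕ (predMod (sucMod i))            ≡⟨ toℕ-predMod (sucMod i) ⟩
  (toℕ (sucMod i) + n) % suc n        ≡⟨ cong (λ x → (x + n) % suc n) (toℕ-sucMod i) ⟩
  (suc (toℕ i) % suc n + n) % suc n   ≡⟨ cong (_% suc n) (+-comm (suc (toℕ i) % suc n) n) ⟩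
  (n + suc (toℕ i) % suc n) % suc n   ≡⟨ [m+n%d]%d≡[m+n]%d n (suc (toℕ i)) (suc n) ⟩
  (n + suc (toℕ i)) % suc n           ≡⟨ cong (_% suc n) (+-comm n (suc (toℕ i))) ⟩
  suc (toℕ i + n) % suc n             ≡⟨ cong (_% suc n) (+-suc (toℕ i) n) ⟨
  (toℕ i + suc n) % suc n             ≡⟨ [i+n]%n≡i i ⟩
  toℕ i                               ∎)

-- If i + 2 ≡ i (mod n) then n divides 2.
sucMod-sucMod≢id : 3 ≤ n → (i : Fin n) → sucMod (sucMod i) ≢ i
sucMod-sucMod≢id {suc n} 3≤n i eq = 2≢q*N q 2≡q*N
  where
  t N q : ℕ
  t = toℕ i
  N = suc n
  q = (2 + t) / N
  [2+t]%N≡t : (2 + t) % N ≡ t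
  [2+t]%N≡t = begin
    (2 + t) % N                ≡⟨ [m+n%d]%d≡[m+n]%d 1 (suc t) N ⟨
    suc (suc t % N) % N        ≡⟨ cong (λ x → suc x % N) (toℕ-sucMod i) ⟨
    suc (toℕ (sucMod i)) % N   ≡⟨ toℕ-sucMod (sucMod i) ⟨
    toℕ (sucMod (sucMod i))    ≡⟨ cong toℕ eq ⟩
    t                          ∎
  2≡q*N : 2 ≡ q * N
  2≡q*N = +-cancelˡ-≡ t _ _ (begin
    t + 2             ≡⟨ +-comm t 2 ⟩
    2 + t             ≡⟨ m≡m%n+[m/n]*n (2 + t) N ⟩
    (2 + t) % N + q * N ≡⟨ cong (_+ q * N) [2+t]%N≡t ⟩
    t + q * N         ∎)
  2≢q*N : ∀ q → 2 ≢ q * N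
  2≢q*N zero ()
  2≢q*N (suc q) 2≡N+qN = 1+n≰n (≤-trans 3≤n (subst (N ≤_) (sym 2≡N+qN) (m≤m+n N (q * N))))

-- Steps, edges and walks in the torus

move : Bool → Fin m → Fin m
move true  = sucMod
move false = predMod

move-not : ∀ d (i : Fin m) → move (not d) (move d i) ≡ i
move-not true  = predMod-sucMod
move-not false = sucMod-predMod

step≡updateAt : ∀ (i : Fin k) d (v : Vertex m k) → step (i , d) v ≡ updateAt v i (move d)
step≡updateAt i true  v = refl
step≡updateAt i false v = refl

flipLabel : Label k → Label k
flipLabel (i , d) = i , not d

step-flipLabel : ∀ (e : Label k) (v : Vertex m k) → step (flipLabel e) (step e v) ≡ v
step-flipLabel (i , d) v = begin
  step (i , not d) (step (i , d) v)                  ≡⟨ step≡updateAt i (not d) _ ⟩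
  updateAt (step (i , d) v) i (move (not d))         ≡⟨ cong (λ w → updateAt w i (move (not d))) (step≡updateAt i d v) ⟩
  updateAt (updateAt v i (move d)) i (move (not d))  ≡⟨ updateAt-updateAt i v ⟩
  updateAt v i (move (not d) ∘ move d)               ≡⟨ updateAt-id-local i v (move-not d _) ⟩
  v                                                  ∎

step-flipLabel⁻ : ∀ (e : Label k) (v : Vertex m k) → step e (step (flipLabel e) v) ≡ v
step-flipLabel⁻ (i , d) v =
  subst (λ d′ → step (i , d′) (step (i , not d) v) ≡ v) (not-involutive d) (step-flipLabel (i , not d) v)

edgeStart : Label k → Vertex m k → Vertex m k
edgeStart (i , true)  v = v
edgeStart (i , false) v = step (i , false) v

edgeOf≡edgeStart : ∀ (v : Vertex m k) e → edgeOf v e ≡ (edgeStart e v , proj₁ e)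
edgeOf≡edgeStart v (i , true)  = refl
edgeOf≡edgeStart v (i , false) = refl

edgeOf-flipLabel : ∀ (v : Vertex m k) e → edgeOf v (flipLabel e) ≡ edgeOf (step (flipLabel e) v) e
edgeOf-flipLabel v (i , true)  = refl
edgeOf-flipLabel v (i , false) = cong (_, i) (sym (step-flipLabel (i , true) v))

edgeOf-endpoints : ∀ (u u′ : Vertex m k) e e′ → edgeOf u e ≡ edgeOf u′ e′ →
                   (u ≡ u′ × step e u ≡ step e′ u′) ⊎ (u ≡ step e′ u′ × step e u ≡ u′)
edgeOf-endpoints u u′ (i , true)  (i′ , true)  refl = inj₁ (refl , refl)
edgeOf-endpoints u u′ (i , false) (i′ , false) eq with cong proj₂ eq
... | refl = inj₁ (u≡u′ , cong proj₁ eq)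
  where
  u≡u′ : u ≡ u′
  u≡u′ = begin
    u                                    ≡⟨ step-flipLabel (i , false) u ⟨
    step (i , true) (step (i , false) u)  ≡⟨ cong (step (i , true) ∘ proj₁) eq ⟩
    step (i , true) (step (i , false) u′) ≡⟨ step-flipLabel (i , false) u′ ⟩
    u′                                   ∎
edgeOf-endpoints u u′ (i , true)  (i′ , false) refl = inj₂ (refl , step-flipLabel⁻ (i , true) u′)
edgeOf-endpoints u u′ (i , false) (i′ , true)  refl = inj₂ (sym (step-flipLabel (i , false) u) , refl)

walk : Vertex m k → List (Label k) → ℕ → Vertex m k
walk v es       zero    = v
walk v []       (suc t) = v
walk v (e ∷ es) (suc t) = walk (step e v) es t

walk-suc : ∀ (v : Vertex m k) es (t : Fin (length es)) →
           walk v es (suc (toℕ t)) ≡ step (List.lookup es t) (walk v es (toℕ t))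
walk-suc v (e ∷ es) fzero    = refl
walk-suc v (e ∷ es) (fsuc t) = walk-suc (step e v) es t

walk-length : ∀ (v : Vertex m k) es → walk v es (length es) ≡ endVertex v es
walk-length v []       = refl
walk-length v (e ∷ es) = walk-length (step e v) es

walk-∈-visited : ∀ (v : Vertex m k) es (t : Fin (length es)) → walk v es (toℕ t) ∈ visited v es
walk-∈-visited v (e ∷ es) fzero    = here refl
walk-∈-visited v (e ∷ es) (fsuc t) = there (walk-∈-visited (step e v) es t)

walk-injective : ∀ (v : Vertex m k) es → Unique (visited v es) →
                 (t t′ : Fin (length es)) → walk v es (toℕ t) ≡ walk v es (toℕ t′) → t ≡ t′
walk-injective v (e ∷ es) u           fzero    fzero     eq = refl
walk-injective v (e ∷ es) (v∉ ∷ u)    fzero    (fsuc t′) eq =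
  ⊥-elim (All.lookup v∉ (walk-∈-visited (step e v) es t′) eq)
walk-injective v (e ∷ es) (v∉ ∷ u)    (fsuc t) fzero     eq =
  ⊥-elim (All.lookup v∉ (walk-∈-visited (step e v) es t) (sym eq))
walk-injective v (e ∷ es) (v∉ ∷ u)    (fsuc t) (fsuc t′) eq =
  cong fsuc (walk-injective (step e v) es u t t′ eq)

edgeOf-walk-∈ : ∀ (v : Vertex m k) es (t : Fin (length es)) →
                edgeOf (walk v es (toℕ t)) (List.lookup es t) ∈ edgesFrom v es
edgeOf-walk-∈ v (e ∷ es) fzero    = here refl
edgeOf-walk-∈ v (e ∷ es) (fsuc t) = there (edgeOf-walk-∈ (step e v) es t)

∈-edgesFrom⁻ : ∀ (v : Vertex m k) es {x} → x ∈ edgesFrom v es →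
               ∃ λ (t : Fin (length es)) → edgeOf (walk v es (toℕ t)) (List.lookup es t) ≡ x
∈-edgesFrom⁻ v (e ∷ es) (here refl) = fzero , refl
∈-edgesFrom⁻ v (e ∷ es) (there x∈)  with ∈-edgesFrom⁻ (step e v) es x∈
... | t , eq = fsuc t , eq

labelAt-lookup : ∀ (es : List (Label k)) (t : Fin (length es)) → labelAt es (toℕ t) ≡ just (List.lookup es t)
labelAt-lookup (e ∷ es) fzero    = refl
labelAt-lookup (e ∷ es) (fsuc t) = labelAt-lookup es t

-- Blocks and permutations of coordinates

lookup-extensionality : {xs ys : Vec A n} → (∀ i → lookup xs i ≡ lookup ys i) → xs ≡ ys
lookup-extensionality {xs = xs} {ys} eq =
  trans (sym (tabulate∘lookup xs)) (trans (tabulate-cong eq) (tabulate∘lookup ys))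


updateAt-++ˡ : ∀ (xs : Vec A m) (ys : Vec A n) i (f : A → A) →
               updateAt (xs ++ ys) (i ↑ˡ n) f ≡ updateAt xs i f ++ ys
updateAt-++ˡ (x ∷ xs) ys fzero    f = refl
updateAt-++ˡ (x ∷ xs) ys (fsuc i) f = cong (x ∷_) (updateAt-++ˡ xs ys i f)

updateAt-++ʳ : ∀ (xs : Vec A m) (ys : Vec A n) i (f : A → A) →
               updateAt (xs ++ ys) (m ↑ʳ i) f ≡ xs ++ updateAt ys i f
updateAt-++ʳ []       ys i f = refl
updateAt-++ʳ (x ∷ xs) ys i f = cong (x ∷_) (updateAt-++ʳ xs ys i f)

concat-updateAt : ∀ (xss : Vec (Vec A n) k) i j (f : A → A) →
                  updateAt (concat xss) (combine i j) f ≡ concat (updateAt xss i (λ xs → updateAt xs j f))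
concat-updateAt (xs ∷ xss) fzero    j f = updateAt-++ˡ xs (concat xss) j f
concat-updateAt (xs ∷ xss) (fsuc i) j f =
  trans (updateAt-++ʳ xs (concat xss) (combine i j) f) (cong (xs ++_) (concat-updateAt xss i j f))

concat-replicate : ∀ (x : A) → concat (replicate k (replicate n x)) ≡ replicate (k * n) x
concat-replicate {k = k} {n} x = lookup-extensionality λ y → lookup-block y
  where
  lookup-block : ∀ y → lookup (concat (replicate k (replicate n x))) y ≡ lookup (replicate (k * n) x) y
  lookup-block y with combine-surjective {k} {n} y
  ... | c , l , refl = begin
    lookup (concat (replicate k (replicate n x))) (combine c l) ≡⟨ lookup-concat (replicate k (replicate n x)) c l ⟩
    lookup (lookup (replicate k (replicate n x)) c) l          ≡⟨ cong (λ xs → lookup xs l) (lookup-replicate c _) ⟩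
    lookup (replicate n x) l                                   ≡⟨ lookup-replicate l x ⟩
    x                                                          ≡⟨ lookup-replicate (combine c l) x ⟨
    lookup (replicate (k * n) x) (combine c l)                 ∎

concat-injective : ∀ (xss yss : Vec (Vec A n) k) → concat xss ≡ concat yss → xss ≡ yss
concat-injective []         []         _  = refl
concat-injective (xs ∷ xss) (ys ∷ yss) eq =
  cong₂ _∷_ (++-injectiveˡ xs ys eq) (concat-injective xss yss (++-injectiveʳ xs ys eq))

step-concat : ∀ (xss : Vec (Vertex m n) k) i j d →
              step (combine i j , d) (concat xss) ≡ concat (updateAt xss i (step (j , d)))
step-concat xss i j true  = concat-updateAt xss i j sucMod
step-concat xss i j false = concat-updateAt xss i j predMod

edgeStart-concat : ∀ (xss : Vec (Vertex m n) k) i j d →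
                   edgeStart (combine i j , d) (concat xss) ≡ concat (updateAt xss i (edgeStart (j , d)))
edgeStart-concat xss i j true  = cong concat (sym (updateAt-id i xss))
edgeStart-concat xss i j false = step-concat xss i j false

permute : Permutation′ k → Vec A k → Vec A k
permute ρ v = tabulate (λ c → lookup v (ρ ⟨$⟩ˡ c))

lookup-permute : ∀ (ρ : Permutation′ k) (v : Vec A k) c → lookup (permute ρ v) (ρ ⟨$⟩ʳ c) ≡ lookup v c
lookup-permute ρ v c = trans (lookup∘tabulate _ (ρ ⟨$⟩ʳ c)) (cong (lookup v) (inverseˡ ρ))

permute-updateAt : ∀ (ρ : Permutation′ k) (v : Vec A k) c f →
                   permute ρ (updateAt v c f) ≡ updateAt (permute ρ v) (ρ ⟨$⟩ʳ c) f
permute-updateAt ρ v c f = lookup-extensionality pointwise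
  where
  pointwise : ∀ c′ → lookup (permute ρ (updateAt v c f)) c′ ≡ lookup (updateAt (permute ρ v) (ρ ⟨$⟩ʳ c) f) c′
  pointwise c′ with c′ ≟ᶠ ρ ⟨$⟩ʳ c
  ... | yes refl = begin
    lookup (permute ρ (updateAt v c f)) (ρ ⟨$⟩ʳ c)    ≡⟨ lookup-permute ρ (updateAt v c f) c ⟩
    lookup (updateAt v c f) c                          ≡⟨ lookup∘updateAt c v ⟩
    f (lookup v c)                                     ≡⟨ cong f (lookup-permute ρ v c) ⟨
    f (lookup (permute ρ v) (ρ ⟨$⟩ʳ c))                ≡⟨ lookup∘updateAt (ρ ⟨$⟩ʳ c) (permute ρ v) ⟨
    lookup (updateAt (permute ρ v) (ρ ⟨$⟩ʳ c) f) (ρ ⟨$⟩ʳ c) ∎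
  ... | no c′≢ρc = begin
    lookup (permute ρ (updateAt v c f)) c′              ≡⟨ lookup∘tabulate _ c′ ⟩
    lookup (updateAt v c f) (ρ ⟨$⟩ˡ c′)                 ≡⟨ lookup∘updateAt′ _ c ρˡc′≢c v ⟩
    lookup v (ρ ⟨$⟩ˡ c′)                                ≡⟨ lookup∘tabulate _ c′ ⟨
    lookup (permute ρ v) c′                             ≡⟨ lookup∘updateAt′ c′ _ c′≢ρc (permute ρ v) ⟨
    lookup (updateAt (permute ρ v) (ρ ⟨$⟩ʳ c) f) c′     ∎
    where
    ρˡc′≢c : ρ ⟨$⟩ˡ c′ ≢ c
    ρˡc′≢c eq = c′≢ρc (trans (sym (inverseʳ ρ)) (cong (ρ ⟨$⟩ʳ_) eq))

step-permute : ∀ (ρ : Permutation′ k) e (v : Vertex m k) →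
               step (actLabel ρ e) (permute ρ v) ≡ permute ρ (step e v)
step-permute ρ (c , d) v = begin
  step (ρ ⟨$⟩ʳ c , d) (permute ρ v)             ≡⟨ step≡updateAt (ρ ⟨$⟩ʳ c) d _ ⟩
  updateAt (permute ρ v) (ρ ⟨$⟩ʳ c) (move d)   ≡⟨ permute-updateAt ρ v c (move d) ⟨
  permute ρ (updateAt v c (move d))            ≡⟨ cong (permute ρ) (step≡updateAt c d v) ⟨
  permute ρ (step (c , d) v)                   ∎

permute-replicate : ∀ (ρ : Permutation′ k) (x : A) → permute ρ (replicate k x) ≡ replicate k x
permute-replicate ρ x = lookup-extensionality λ c →
  trans (lookup∘tabulate _ c) (trans (lookup-replicate (ρ ⟨$⟩ˡ c) x) (sym (lookup-replicate c x)))

mapBlocks : (Fin k → Fin k) → (Fin n → Fin n) → Fin (k * n) → Fin (k * n)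
mapBlocks {n = n} f g x = uncurry (λ c l → combine (f c) (g l)) (remQuot n x)

mapBlocks-combine : ∀ (f : Fin k → Fin k) (g : Fin n → Fin n) c l →
                    mapBlocks f g (combine c l) ≡ combine (f c) (g l)
mapBlocks-combine {k} {n} f g c l =
  cong (uncurry (λ c l → combine (f c) (g l))) (remQuot-combine {k} {n} c l)

mapBlocks-inverse : ∀ {f f′ : Fin k → Fin k} {g g′ : Fin n → Fin n} →
                    (∀ c → f (f′ c) ≡ c) → (∀ l → g (g′ l) ≡ l) →
                    ∀ x → mapBlocks f g (mapBlocks f′ g′ x) ≡ x
mapBlocks-inverse {k} {n} {f} {f′} {g} {g′} ff′ gg′ x with combine-surjective {k} {n} x
... | c , l , refl = begin
  mapBlocks f g (mapBlocks f′ g′ (combine c l)) ≡⟨ cong (mapBlocks f g) (mapBlocks-combine f′ g′ c l) ⟩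
  mapBlocks f g (combine (f′ c) (g′ l))         ≡⟨ mapBlocks-combine f g (f′ c) (g′ l) ⟩
  combine (f (f′ c)) (g (g′ l))                 ≡⟨ cong₂ combine (ff′ c) (gg′ l) ⟩
  combine c l                                   ∎

blockPerm : Permutation′ k → Permutation′ n → Permutation′ (k * n)
blockPerm ρ σ = permutation (mapBlocks (ρ ⟨$⟩ʳ_) (σ ⟨$⟩ʳ_)) (mapBlocks (ρ ⟨$⟩ˡ_) (σ ⟨$⟩ˡ_))
  (mapBlocks-inverse {f = ρ ⟨$⟩ʳ_} {ρ ⟨$⟩ˡ_} {σ ⟨$⟩ʳ_} {σ ⟨$⟩ˡ_} (λ _ → inverseʳ ρ) (λ _ → inverseʳ σ))
  (mapBlocks-inverse {f = ρ ⟨$⟩ˡ_} {ρ ⟨$⟩ʳ_} {σ ⟨$⟩ˡ_} {σ ⟨$⟩ʳ_} (λ _ → inverseˡ ρ) (λ _ → inverseˡ σ))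

blockPerm-combine : ∀ (ρ : Permutation′ k) (σ : Permutation′ n) c l →
                    blockPerm ρ σ ⟨$⟩ʳ combine c l ≡ combine (ρ ⟨$⟩ʳ c) (σ ⟨$⟩ʳ l)
blockPerm-combine ρ σ = mapBlocks-combine (ρ ⟨$⟩ʳ_) (σ ⟨$⟩ʳ_)

productFamily : (Fin k → Permutation′ k) → (Fin n → Permutation′ n) → Fin (k * n) → Permutation′ (k * n)
productFamily {n = n} ρ σ x = uncurry (λ j i → blockPerm (ρ j) (σ i)) (remQuot n x)

productFamily-combine : ∀ (ρ : Fin k → Permutation′ k) (σ : Fin n → Permutation′ n) j i →
                        productFamily ρ σ (combine j i) ≡ blockPerm (ρ j) (σ i)
productFamily-combine {k} {n} ρ σ j i =
  cong (uncurry (λ j i → blockPerm (ρ j) (σ i))) (remQuot-combine {k} {n} j i)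

isLatinFamily-product : {ρ : Fin k → Permutation′ k} {σ : Fin n → Permutation′ n} →
                        IsLatinFamily ρ → IsLatinFamily σ → IsLatinFamily (productFamily ρ σ)
isLatinFamily-product {k} {n} {ρ} {σ} ((j₁ , ρj₁≡id) , ρ-latin) ((i₁ , σi₁≡id) , σ-latin) =
  (combine j₁ i₁ , identity) , columns-injective
  where
  productFamily-apply : ∀ j i c l → productFamily ρ σ (combine j i) ⟨$⟩ʳ combine c l ≡ combine (ρ j ⟨$⟩ʳ c) (σ i ⟨$⟩ʳ l)
  productFamily-apply j i c l =
    trans (cong (_⟨$⟩ʳ combine c l) (productFamily-combine ρ σ j i)) (blockPerm-combine (ρ j) (σ i) c l)

  identity : ∀ y → productFamily ρ σ (combine j₁ i₁) ⟨$⟩ʳ y ≡ y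
  identity y with combine-surjective {k} {n} y
  ... | c , l , refl = trans (productFamily-apply j₁ i₁ c l) (cong₂ combine (ρj₁≡id c) (σi₁≡id l))

  columns-injective : ∀ y x x′ → productFamily ρ σ x ⟨$⟩ʳ y ≡ productFamily ρ σ x′ ⟨$⟩ʳ y → x ≡ x′
  columns-injective y x x′ eq
    with combine-surjective {k} {n} y | combine-surjective {k} {n} x | combine-surjective {k} {n} x′
  ... | c , l , refl | j , i , refl | j′ , i′ , refl =
    cong₂ combine (ρ-latin c j j′ (combine-injectiveˡ _ (σ i ⟨$⟩ʳ l) _ (σ i′ ⟨$⟩ʳ l) eq′))
                  (σ-latin l i i′ (combine-injectiveʳ (ρ j ⟨$⟩ʳ c) _ (ρ j′ ⟨$⟩ʳ c) _ eq′))
    where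
    eq′ : combine (ρ j ⟨$⟩ʳ c) (σ i ⟨$⟩ʳ l) ≡ combine (ρ j′ ⟨$⟩ʳ c) (σ i′ ⟨$⟩ʳ l)
    eq′ = trans (sym (productFamily-apply j i c l)) (trans eq (productFamily-apply j′ i′ c l))

-- Positions on a Hamilton cycle

injective⇒surjective : DecidableEquality A → {f : Fin n → A} {g : A → Fin n} →
                       Injective _≡_ _≡_ f → Injective _≡_ _≡_ g → ∀ y → ∃ λ x → f x ≡ y
injective⇒surjective {n = n} _≟_ {f} {g} f-inj g-inj y with any? (λ x → f x ≟ y)
... | yes fx≡y = fx≡y
... | no  f≢y  = ⊥-elim (1+n≰n (injective⇒≤ h-inj))
  where
  h : Fin (suc n) → Fin n
  h fzero    = g y
  h (fsuc x) = g (f x)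
  h-inj : Injective _≡_ _≡_ h
  h-inj {fzero}  {fzero}  _  = refl
  h-inj {fzero}  {fsuc x} eq = ⊥-elim (f≢y (x , sym (g-inj eq)))
  h-inj {fsuc x} {fzero}  eq = ⊥-elim (f≢y (x , g-inj eq))
  h-inj {fsuc x} {fsuc x′} eq = cong fsuc (f-inj (g-inj eq))

encode : Vec (Fin m) k → Fin (m ^ k)
encode v = funToFin (lookup v)

encode-injective : Injective _≡_ _≡_ (encode {m} {k})
encode-injective {x = u} {v} eq = lookup-extensionality λ i → begin
  lookup u i                       ≡⟨ finToFun-funToFin (lookup u) i ⟨
  finToFun (funToFin (lookup u)) i ≡⟨ cong (λ c → finToFun c i) eq ⟩
  finToFun (funToFin (lookup v)) i ≡⟨ finToFun-funToFin (lookup v) i ⟩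
  lookup v i                       ∎

module HamiltonCycle .{{_ : NonZero m}} (E : List (Label k)) (hamE : IsHamCycle m k E) where

  instance
    m^k-nonZero : NonZero (m ^ k)
    m^k-nonZero = m^n≢0 m k

  private
    o : Vertex m k
    o = origin m k

    length≡ : length E ≡ m ^ k
    length≡ = proj₁ hamE

    index : Fin (m ^ k) → Fin (length E)
    index = cast (sym length≡)

    toℕ-index : ∀ a → toℕ (index a) ≡ toℕ a
    toℕ-index = toℕ-cast (sym length≡)

    walk-closed : ∀ t → t ≤ m ^ k → walk o E (t % m ^ k) ≡ walk o E t
    walk-closed t t≤ with m≤n⇒m<n∨m≡n t≤
    ... | inj₁ t< = cong (walk o E) (m<n⇒m%n≡m t<)
    ... | inj₂ refl = begin
      walk o E (m ^ k % m ^ k) ≡⟨ cong (walk o E) (n%n≡0 (m ^ k)) ⟩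
      o                        ≡⟨ proj₂ (proj₂ hamE) ⟨
      endVertex o E            ≡⟨ walk-length o E ⟨
      walk o E (length E)      ≡⟨ cong (walk o E) length≡ ⟩
      walk o E (m ^ k)         ∎

  -- vertexAt is φ_E⁻¹ and positionOf below is φ_E.
  vertexAt : Fin (m ^ k) → Vertex m k
  vertexAt a = walk o E (toℕ a)

  edgeLabel : Fin (m ^ k) → Label k
  edgeLabel a = List.lookup E (index a)

  edgeAt : Fin (m ^ k) → Edge m k
  edgeAt a = edgeOf (vertexAt a) (edgeLabel a)

  private
    vertexAt≡walk-index : ∀ a → vertexAt a ≡ walk o E (toℕ (index a))
    vertexAt≡walk-index a = cong (walk o E) (sym (toℕ-index a))

  labelAt-edgeLabel : ∀ a → labelAt E (toℕ a) ≡ just (edgeLabel a)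
  labelAt-edgeLabel a = subst (λ t → labelAt E t ≡ just (edgeLabel a)) (toℕ-index a) (labelAt-lookup E (index a))

  vertexAt-sucMod : ∀ a → vertexAt (sucMod a) ≡ step (edgeLabel a) (vertexAt a)
  vertexAt-sucMod a = begin
    walk o E (toℕ (sucMod a))                  ≡⟨ cong (walk o E) (toℕ-sucMod a) ⟩
    walk o E (suc (toℕ a) % m ^ k)             ≡⟨ walk-closed (suc (toℕ a)) (toℕ<n a) ⟩
    walk o E (suc (toℕ a))                     ≡⟨ cong (walk o E ∘ suc) (toℕ-index a) ⟨
    walk o E (suc (toℕ (index a)))             ≡⟨ walk-suc o E (index a) ⟩
    step (edgeLabel a) (walk o E (toℕ (index a))) ≡⟨ cong (step (edgeLabel a)) (vertexAt≡walk-index a) ⟨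
    step (edgeLabel a) (vertexAt a)            ∎

  stepLabel : Bool → Fin (m ^ k) → Label k
  stepLabel true  a = edgeLabel a
  stepLabel false a = flipLabel (edgeLabel (predMod a))

  vertexAt-move : ∀ d a → vertexAt (move d a) ≡ step (stepLabel d a) (vertexAt a)
  vertexAt-move true  a = vertexAt-sucMod a
  vertexAt-move false a = begin
    vertexAt (predMod a)                                  ≡⟨ step-flipLabel ℓ _ ⟨
    step (flipLabel ℓ) (step ℓ (vertexAt (predMod a)))    ≡⟨ cong (step (flipLabel ℓ)) (vertexAt-sucMod (predMod a)) ⟨
    step (flipLabel ℓ) (vertexAt (sucMod (predMod a)))    ≡⟨ cong (step (flipLabel ℓ) ∘ vertexAt) (sucMod-predMod a) ⟩
    step (flipLabel ℓ) (vertexAt a)                       ∎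
    where
    ℓ : Label k
    ℓ = edgeLabel (predMod a)

  vertexAt-injective : Injective _≡_ _≡_ vertexAt
  vertexAt-injective {a} {b} eq = toℕ-injective (begin
    toℕ a          ≡⟨ toℕ-index a ⟨
    toℕ (index a)  ≡⟨ cong toℕ index-eq ⟩
    toℕ (index b)  ≡⟨ toℕ-index b ⟩
    toℕ b          ∎)
    where
    index-eq : index a ≡ index b
    index-eq = walk-injective o E (proj₁ (proj₂ hamE)) (index a) (index b)
      (trans (sym (vertexAt≡walk-index a)) (trans eq (vertexAt≡walk-index b)))

  vertexAt-surjective : ∀ v → ∃ λ a → vertexAt a ≡ v
  vertexAt-surjective = injective⇒surjective (≡-dec _≟ᶠ_) vertexAt-injective encode-injective

  positionOf : Vertex m k → Fin (m ^ k)
  positionOf v = proj₁ (vertexAt-surjective v)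

  vertexAt-positionOf : ∀ v → vertexAt (positionOf v) ≡ v
  vertexAt-positionOf v = proj₂ (vertexAt-surjective v)

  edgeAt-∈ : ∀ a → edgeAt a ∈ edges m k E
  edgeAt-∈ a = subst (λ v → edgeOf v (edgeLabel a) ∈ edges m k E) (sym (vertexAt≡walk-index a))
    (edgeOf-walk-∈ o E (index a))

  ∈-edges⇒edgeAt : ∀ {x} → x ∈ edges m k E → ∃ λ a → edgeAt a ≡ x
  ∈-edges⇒edgeAt x∈ with ∈-edgesFrom⁻ o E x∈
  ... | t , refl = cast length≡ t , cong₂ edgeOf (cong (walk o E) (toℕ-cast length≡ t)) (cong (List.lookup E) index∘cast)
    where
    index∘cast : index (cast length≡ t) ≡ t
    index∘cast = toℕ-injective (trans (toℕ-index (cast length≡ t)) (toℕ-cast length≡ t))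

  -- Equal edges at different positions would be traversed in opposite directions, so the
  -- positions would be consecutive in both orders, forcing b + 2 ≡ b.
  edgeAt-injective : 3 ≤ m ^ k → Injective _≡_ _≡_ edgeAt
  edgeAt-injective 3≤ {a} {b} eq
    with edgeOf-endpoints (vertexAt a) (vertexAt b) (edgeLabel a) (edgeLabel b) eq
  ... | inj₁ (a≡b , _) = vertexAt-injective a≡b
  ... | inj₂ (a≡b+1 , a+1≡b) = ⊥-elim (sucMod-sucMod≢id 3≤ b (trans (cong sucMod b+1≡a) a+1≡b′))
    where
    b+1≡a : sucMod b ≡ a
    b+1≡a = vertexAt-injective (trans (vertexAt-sucMod b) (sym a≡b+1))
    a+1≡b′ : sucMod a ≡ b
    a+1≡b′ = vertexAt-injective (trans (vertexAt-sucMod a) a+1≡b)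

-- Lifting along a Hamilton cycle of Q_{2n}

module Lift {n} (E : List (Label n)) (hamE : IsHamCycle 4 n E) where

  open HamiltonCycle E hamE public

  -- liftVertex inverts (u , v , w) ↦ (φ_E u , φ_E v , φ_E w), and liftEdge maps an edge of G_{n,3}
  -- to its preimage in Q_{6n}.
  liftVertex : Vertex (4 ^ n) 3 → Vertex 4 (3 * n)
  liftVertex p = concat (map vertexAt p)

  liftLabel : Vertex (4 ^ n) 3 → Label 3 → Label (3 * n)
  liftLabel p (c , d) = shift c (stepLabel d (lookup p c))

  liftEdge : Edge (4 ^ n) 3 → Edge 4 (3 * n)
  liftEdge (q , c) = edgeOf (liftVertex q) (shift c (edgeLabel (lookup q c)))

  gStep≡liftLabel : ∀ p e → gStep E p e ≡ just (liftLabel p e)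
  gStep≡liftLabel p (c , true)  rewrite labelAt-edgeLabel (lookup p c)           = refl
  gStep≡liftLabel p (c , false) rewrite labelAt-edgeLabel (predMod (lookup p c)) = refl

  gFrom-∷ : ∀ p e es → gFrom E p (e ∷ es) ≡ liftLabel p e ∷ gFrom E (step e p) es
  gFrom-∷ p e es rewrite gStep≡liftLabel p e = refl

  step-liftLabel : ∀ p e → step (liftLabel p e) (liftVertex p) ≡ liftVertex (step e p)
  step-liftLabel p (c , d) = begin
    step (shift c ℓ) (concat (map vertexAt p))          ≡⟨ step-concat (map vertexAt p) c (proj₁ ℓ) (proj₂ ℓ) ⟩
    concat (updateAt (map vertexAt p) c (step ℓ))       ≡⟨ cong concat (map-updateAt p c (vertexAt-move d (lookup p c))) ⟨
    concat (map vertexAt (updateAt p c (move d)))       ≡⟨ cong liftVertex (step≡updateAt c d p) ⟨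
    liftVertex (step (c , d) p)                         ∎
    where
    ℓ : Label n
    ℓ = stepLabel d (lookup p c)

  edgeOf-liftLabel : ∀ p e → edgeOf (liftVertex p) (liftLabel p e) ≡ liftEdge (edgeOf p e)
  edgeOf-liftLabel p (c , true)  = refl
  edgeOf-liftLabel p (c , false) = begin
    edgeOf (liftVertex p) (flipLabel (shift c ℓ))                         ≡⟨ edgeOf-flipLabel (liftVertex p) (shift c ℓ) ⟩
    edgeOf (step (liftLabel p (c , false)) (liftVertex p)) (shift c ℓ)    ≡⟨ cong (λ v → edgeOf v (shift c ℓ)) (step-liftLabel p (c , false)) ⟩
    edgeOf (liftVertex q) (shift c ℓ)                                     ≡⟨ cong (λ a → edgeOf (liftVertex q) (shift c (edgeLabel a))) (lookup∘updateAt c p) ⟨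
    liftEdge (q , c)                                                      ∎
    where
    q : Vertex (4 ^ n) 3
    q = step (c , false) p
    ℓ : Label n
    ℓ = edgeLabel (predMod (lookup p c))

  length-gFrom : ∀ p H → length (gFrom E p H) ≡ length H
  length-gFrom p []       = refl
  length-gFrom p (e ∷ es) rewrite gFrom-∷ p e es = cong suc (length-gFrom (step e p) es)

  visited-gFrom : ∀ p H → visited (liftVertex p) (gFrom E p H) ≡ List.map liftVertex (visited p H)
  visited-gFrom p []       = refl
  visited-gFrom p (e ∷ es) rewrite gFrom-∷ p e es = cong (liftVertex p ∷_) (begin
    visited (step (liftLabel p e) (liftVertex p)) (gFrom E (step e p) es) ≡⟨ cong (λ v → visited v (gFrom E (step e p) es)) (step-liftLabel p e) ⟩
    visited (liftVertex (step e p)) (gFrom E (step e p) es)               ≡⟨ visited-gFrom (step e p) es ⟩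
    List.map liftVertex (visited (step e p) es)                           ∎)

  endVertex-gFrom : ∀ p H → endVertex (liftVertex p) (gFrom E p H) ≡ liftVertex (endVertex p H)
  endVertex-gFrom p []       = refl
  endVertex-gFrom p (e ∷ es) rewrite gFrom-∷ p e es =
    trans (cong (λ v → endVertex v (gFrom E (step e p) es)) (step-liftLabel p e)) (endVertex-gFrom (step e p) es)

  edgesFrom-gFrom : ∀ p H → edgesFrom (liftVertex p) (gFrom E p H) ≡ List.map liftEdge (edgesFrom p H)
  edgesFrom-gFrom p []       = refl
  edgesFrom-gFrom p (e ∷ es) rewrite gFrom-∷ p e es = cong₂ _∷_ (edgeOf-liftLabel p e) (begin
    edgesFrom (step (liftLabel p e) (liftVertex p)) (gFrom E (step e p) es) ≡⟨ cong (λ v → edgesFrom v (gFrom E (step e p) es)) (step-liftLabel p e) ⟩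
    edgesFrom (liftVertex (step e p)) (gFrom E (step e p) es)               ≡⟨ edgesFrom-gFrom (step e p) es ⟩
    List.map liftEdge (edgesFrom (step e p) es)                             ∎)

  liftVertex-injective : Injective _≡_ _≡_ liftVertex
  liftVertex-injective {p} {p′} eq = lookup-extensionality λ c → vertexAt-injective (begin
    vertexAt (lookup p c)        ≡⟨ lookup-map c vertexAt p ⟨
    lookup (map vertexAt p) c    ≡⟨ cong (λ B → lookup B c) (concat-injective (map vertexAt p) (map vertexAt p′) eq) ⟩
    lookup (map vertexAt p′) c   ≡⟨ lookup-map c vertexAt p′ ⟩
    vertexAt (lookup p′ c)       ∎)

  liftVertex-origin : liftVertex (origin (4 ^ n) 3) ≡ origin 4 (3 * n)
  liftVertex-origin = begin
    concat (map vertexAt (replicate 3 (0 mod 4 ^ n)))  ≡⟨ cong concat (map-replicate vertexAt (0 mod 4 ^ n) 3) ⟩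
    concat (replicate 3 (vertexAt (0 mod 4 ^ n)))      ≡⟨ cong (λ t → concat (replicate 3 (walk (origin 4 n) E t))) (toℕ-0mod (4 ^ n)) ⟩
    concat (replicate 3 (origin 4 n))                  ≡⟨ concat-replicate {k = 3} {n} (0 mod 4) ⟩
    origin 4 (3 * n)                                   ∎

  isHamCycle-g : ∀ H → IsHamCycle (4 ^ n) 3 H → IsHamCycle 4 (3 * n) (g n E H)
  isHamCycle-g H (length≡ , unique , closed) = length-g , unique-g , closed-g
    where
    o : Vertex (4 ^ n) 3
    o = origin (4 ^ n) 3
    length-g : length (g n E H) ≡ 4 ^ (3 * n)
    length-g = begin
      length (gFrom E o H)  ≡⟨ length-gFrom o H ⟩
      length H              ≡⟨ length≡ ⟩
      (4 ^ n) ^ 3           ≡⟨ ^-*-assoc 4 n 3 ⟩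
      4 ^ (n * 3)           ≡⟨ cong (4 ^_) (*-comm n 3) ⟩
      4 ^ (3 * n)           ∎
    unique-g : Unique (visited (origin 4 (3 * n)) (g n E H))
    unique-g = subst (λ v → Unique (visited v (g n E H))) liftVertex-origin
      (subst Unique (sym (visited-gFrom o H)) (map⁺ (λ eq → liftVertex-injective eq) unique))
    closed-g : endVertex (origin 4 (3 * n)) (g n E H) ≡ origin 4 (3 * n)
    closed-g = subst (λ v → endVertex v (g n E H) ≡ v) liftVertex-origin
      (trans (endVertex-gFrom o H) (cong liftVertex closed))

  edges-g : ∀ H → edges 4 (3 * n) (g n E H) ≡ List.map liftEdge (edges (4 ^ n) 3 H)
  edges-g H = subst (λ v → edgesFrom v (g n E H) ≡ List.map liftEdge (edges (4 ^ n) 3 H)) liftVertex-origin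
    (edgesFrom-gFrom (origin (4 ^ n) 3) H)

  edgeAt-axis : ∀ a → proj₂ (edgeAt a) ≡ proj₁ (edgeLabel a)
  edgeAt-axis a = cong proj₂ (edgeOf≡edgeStart (vertexAt a) (edgeLabel a))

  liftEdgeBlocks : Edge (4 ^ n) 3 → Vec (Vertex 4 n) 3
  liftEdgeBlocks (q , c) = updateAt (map vertexAt q) c (edgeStart (edgeLabel (lookup q c)))

  liftEdge≡concat : ∀ q c → liftEdge (q , c) ≡ (concat (liftEdgeBlocks (q , c)) , combine c (proj₂ (edgeAt (lookup q c))))
  liftEdge≡concat q c = begin
    edgeOf (liftVertex q) (shift c ℓ)                             ≡⟨ edgeOf≡edgeStart (liftVertex q) (shift c ℓ) ⟩
    (edgeStart (shift c ℓ) (liftVertex q) , combine c (proj₁ ℓ)) ≡⟨ cong₂ _,_ (edgeStart-concat (map vertexAt q) c (proj₁ ℓ) (proj₂ ℓ))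
                                                                             (cong (combine c) (sym (edgeAt-axis (lookup q c)))) ⟩
    (concat (liftEdgeBlocks (q , c)) , combine c (proj₂ (edgeAt (lookup q c)))) ∎
    where
    ℓ : Label n
    ℓ = edgeLabel (lookup q c)

  lookup-liftEdgeBlocks : ∀ q c → lookup (liftEdgeBlocks (q , c)) c ≡ proj₁ (edgeAt (lookup q c))
  lookup-liftEdgeBlocks q c = begin
    lookup (liftEdgeBlocks (q , c)) c         ≡⟨ lookup∘updateAt c (map vertexAt q) ⟩
    edgeStart ℓ (lookup (map vertexAt q) c)   ≡⟨ cong (edgeStart ℓ) (lookup-map c vertexAt q) ⟩
    edgeStart ℓ (vertexAt (lookup q c))       ≡⟨ cong proj₁ (edgeOf≡edgeStart (vertexAt (lookup q c)) ℓ) ⟨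
    proj₁ (edgeAt (lookup q c))               ∎
    where
    ℓ : Label n
    ℓ = edgeLabel (lookup q c)

  lookup-liftEdgeBlocks′ : ∀ q c b → b ≢ c → lookup (liftEdgeBlocks (q , c)) b ≡ vertexAt (lookup q b)
  lookup-liftEdgeBlocks′ q c b b≢c = trans (lookup∘updateAt′ b c b≢c (map vertexAt q)) (lookup-map b vertexAt q)

  liftEdge-onto : ∀ (W : Vec (Vertex 4 n) 3) c a → proj₁ (edgeAt a) ≡ lookup W c →
                  ∃ λ q → liftEdge (q , c) ≡ (concat W , combine c (proj₂ (edgeAt a)))
  liftEdge-onto W c a edgeAt≡W =
    q , trans (liftEdge≡concat q c) (cong₂ _,_ (cong concat blocks≡W) (cong (combine c ∘ proj₂ ∘ edgeAt) q-c))
    where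
    q : Vertex (4 ^ n) 3
    q = updateAt (map positionOf W) c (λ _ → a)
    q-c : lookup q c ≡ a
    q-c = lookup∘updateAt c (map positionOf W)
    blocks≡W : liftEdgeBlocks (q , c) ≡ W
    blocks≡W = lookup-extensionality pointwise
      where
      pointwise : ∀ b → lookup (liftEdgeBlocks (q , c)) b ≡ lookup W b
      pointwise b with b ≟ᶠ c
      ... | yes refl = trans (lookup-liftEdgeBlocks q c) (trans (cong (proj₁ ∘ edgeAt) q-c) edgeAt≡W)
      ... | no b≢c = begin
        lookup (liftEdgeBlocks (q , c)) b     ≡⟨ lookup-liftEdgeBlocks′ q c b b≢c ⟩
        vertexAt (lookup q b)                 ≡⟨ cong vertexAt (lookup∘updateAt′ b c b≢c (map positionOf W)) ⟩
        vertexAt (lookup (map positionOf W) b) ≡⟨ cong vertexAt (lookup-map b positionOf W) ⟩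
        vertexAt (positionOf (lookup W b))    ≡⟨ vertexAt-positionOf (lookup W b) ⟩
        lookup W b                            ∎

-- The decomposition {g(E_i,H_j)}

module _ {n} {E E′ : List (Label n)} (hamE : IsHamCycle 4 n E) (hamE′ : IsHamCycle 4 n E′) where

  private
    module L  = Lift E hamE
    module L′ = Lift E′ hamE′

    liftEdge≡⇒concat≡ : ∀ q c q′ c′ → L.liftEdge (q , c) ≡ L′.liftEdge (q′ , c′) →
      (concat (L.liftEdgeBlocks (q , c)) , combine c (proj₂ (L.edgeAt (lookup q c)))) ≡
      (concat (L′.liftEdgeBlocks (q′ , c′)) , combine c′ (proj₂ (L′.edgeAt (lookup q′ c′))))
    liftEdge≡⇒concat≡ q c q′ c′ eq = trans (sym (L.liftEdge≡concat q c)) (trans eq (L′.liftEdge≡concat q′ c′))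

  liftEdge≡⇒block≡ : ∀ q c q′ c′ → L.liftEdge (q , c) ≡ L′.liftEdge (q′ , c′) → c ≡ c′
  liftEdge≡⇒block≡ q c q′ c′ eq = combine-injectiveˡ c _ c′ _ (cong proj₂ (liftEdge≡⇒concat≡ q c q′ c′ eq))

  liftEdge≡⇒blocks≡ : ∀ q q′ c → L.liftEdge (q , c) ≡ L′.liftEdge (q′ , c) →
    L.edgeAt (lookup q c) ≡ L′.edgeAt (lookup q′ c) ×
    (∀ b → b ≢ c → L.vertexAt (lookup q b) ≡ L′.vertexAt (lookup q′ b))
  liftEdge≡⇒blocks≡ q q′ c eq =
    cong₂ _,_ (lookup-blocks c (L.lookup-liftEdgeBlocks q c) (L′.lookup-liftEdgeBlocks q′ c))
              (combine-injectiveʳ c _ c _ (cong proj₂ (liftEdge≡⇒concat≡ q c q′ c eq))) ,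
    λ b b≢c → lookup-blocks b (L.lookup-liftEdgeBlocks′ q c b b≢c) (L′.lookup-liftEdgeBlocks′ q′ c b b≢c)
    where
    lookup-blocks : ∀ b {x x′} → lookup (L.liftEdgeBlocks (q , c)) b ≡ x → lookup (L′.liftEdgeBlocks (q′ , c)) b ≡ x′ → x ≡ x′
    lookup-blocks b B≡x B′≡x′ =
      trans (sym B≡x) (trans (cong (λ B → lookup B b) (concat-injective (L.liftEdgeBlocks (q , c)) (L′.liftEdgeBlocks (q′ , c)) (cong proj₁ (liftEdge≡⇒concat≡ q c q′ c eq)))) B′≡x′)

liftEdge-injective : ∀ {n} {E : List (Label n)} (hamE : IsHamCycle 4 n E) → 3 ≤ 4 ^ n →
                     Injective _≡_ _≡_ (Lift.liftEdge E hamE)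
liftEdge-injective hamE 3≤ {q , c} {q′ , c′} eq with liftEdge≡⇒block≡ hamE hamE q c q′ c′ eq
... | refl = cong (_, c) (lookup-extensionality pointwise)
  where
  open Lift _ hamE
  pointwise : ∀ b → lookup q b ≡ lookup q′ b
  pointwise b with b ≟ᶠ c
  ... | yes refl = edgeAt-injective 3≤ (proj₁ (liftEdge≡⇒blocks≡ hamE hamE q q′ c eq))
  ... | no b≢c   = vertexAt-injective (proj₂ (liftEdge≡⇒blocks≡ hamE hamE q q′ c eq) b b≢c)

gFamily-combine : ∀ n (E : Fin n → List (Label n)) (H : Fin 3 → List (Label 3)) j i →
                  gFamily n E H (combine j i) ≡ g n (E i) (H j)
gFamily-combine n E H j i =
  trans (gFamily≡ (combine j i)) (cong (λ (j , i) → g n (E i) (H j)) (remQuot-combine {3} {n} j i))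
  where
  gFamily≡ : ∀ x → gFamily n E H x ≡ uncurry (λ j i → g n (E i) (H j)) (remQuot {3} n x)
  gFamily≡ x with remQuot {3} n x
  ... | j , i = refl

module Decomposition {n} (3≤4^n : 3 ≤ 4 ^ n)
  (H : Fin 3 → List (Label 3)) (hdH : IsHD (4 ^ n) 3 {{4^n-nonZero n}} H)
  (E : Fin n → List (Label n)) (hdE : IsHD 4 n E) where

  private
    instance
      4^n-nonZero′ : NonZero (4 ^ n)
      4^n-nonZero′ = 4^n-nonZero n

    module L (i : Fin n) = Lift (E i) (proj₁ hdE i)

    ∈-edges-g⁻ : ∀ {i j x} → x ∈ edges 4 (3 * n) (g n (E i) (H j)) →
                 ∃ λ y → y ∈ edges (4 ^ n) 3 (H j) × x ≡ L.liftEdge i y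
    ∈-edges-g⁻ {i} {j} x∈ = ∈-map⁻ (L.liftEdge i) (subst (_ ∈_) (L.edges-g i (H j)) x∈)

    ∈-edges-g⁺ : ∀ {i j y} → y ∈ edges (4 ^ n) 3 (H j) → L.liftEdge i y ∈ edges 4 (3 * n) (g n (E i) (H j))
    ∈-edges-g⁺ {i} {j} y∈ = subst (_ ∈_) (sym (L.edges-g i (H j))) (∈-map⁺ (L.liftEdge i) y∈)

    edgeAt-∈-unique : ∀ {i i′} a a′ → L.edgeAt i a ≡ L.edgeAt i′ a′ → i ≡ i′
    edgeAt-∈-unique {i} {i′} a a′ eq =
      proj₂ (proj₂ hdE _ _) i i′ (L.edgeAt-∈ i a) (subst (_∈ edges 4 n (E i′)) (sym eq) (L.edgeAt-∈ i′ a′))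

    liftEdge-unique : ∀ {i i′ j j′} y y′ → y ∈ edges (4 ^ n) 3 (H j) → y′ ∈ edges (4 ^ n) 3 (H j′) →
                      L.liftEdge i y ≡ L.liftEdge i′ y′ → i ≡ i′ × j ≡ j′
    liftEdge-unique {i} {i′} {j} {j′} (q , c) (q′ , c′) y∈ y′∈ eq
      with liftEdge≡⇒block≡ (proj₁ hdE i) (proj₁ hdE i′) q c q′ c′ eq
    ... | refl with edgeAt-∈-unique (lookup q c) (lookup q′ c) (proj₁ (liftEdge≡⇒blocks≡ (proj₁ hdE i) (proj₁ hdE i′) q q′ c eq))
    ... | refl = refl , proj₂ (proj₂ hdH q c) j j′ y∈ (subst (_∈ edges (4 ^ n) 3 (H j′)) (sym y≡y′) y′∈)
      where
      y≡y′ : (q , c) ≡ (q′ , c)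
      y≡y′ = liftEdge-injective (proj₁ hdE i) 3≤4^n eq

  isHD-gFamily : IsHD 4 (3 * n) (gFamily n E H)
  isHD-gFamily = hamiltonian , λ w x → covered w x , unique w x
    where
    hamiltonian : ∀ y → IsHamCycle 4 (3 * n) (gFamily n E H y)
    hamiltonian y with combine-surjective {3} {n} y
    ... | j , i , refl rewrite gFamily-combine n E H j i = L.isHamCycle-g i (H j) (proj₁ hdH j)

    covered : ∀ w x → ∃ λ y → (w , x) ∈ edges 4 (3 * n) (gFamily n E H y)
    covered w x with combine-surjective {3} {n} x | group 3 n w
    ... | c , l , refl | W , refl with proj₁ (proj₂ hdE (lookup W c) l)
    ... | i , ∈Ei with L.∈-edges⇒edgeAt i ∈Ei
    ... | a , edgeAt≡ with L.liftEdge-onto i W c a (cong proj₁ edgeAt≡)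
    ... | q , liftEdge≡ with proj₁ (proj₂ hdH q c)
    ... | j , ∈Hj = combine j i , subst₂ (λ e T → e ∈ edges 4 (3 * n) T)
      (trans liftEdge≡ (cong (λ l → concat W , combine c l) (cong proj₂ edgeAt≡)))
      (sym (gFamily-combine n E H j i))
      (∈-edges-g⁺ ∈Hj)

    unique : ∀ w x y y′ → (w , x) ∈ edges 4 (3 * n) (gFamily n E H y) →
             (w , x) ∈ edges 4 (3 * n) (gFamily n E H y′) → y ≡ y′
    unique w x y y′ ∈y ∈y′ with combine-surjective {3} {n} y | combine-surjective {3} {n} y′
    ... | j , i , refl | j′ , i′ , refl
      rewrite gFamily-combine n E H j i | gFamily-combine n E H j′ i′
      with ∈-edges-g⁻ ∈y | ∈-edges-g⁻ ∈y′
    ... | z , z∈ , x≡ | z′ , z′∈ , x≡′ with liftEdge-unique z z′ z∈ z′∈ (trans (sym x≡) x≡′)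
    ... | refl , refl = refl

-- Equivariance of g

labelAt-act : ∀ (σ : Permutation′ k) (E : List (Label k)) t →
              labelAt (act σ E) t ≡ Maybe.map (actLabel σ) (labelAt E t)
labelAt-act σ []       t       = refl
labelAt-act σ (e ∷ E)  zero    = refl
labelAt-act σ (e ∷ E)  (suc t) = labelAt-act σ E t

module _ {n} (ρ : Permutation′ 3) (σ : Permutation′ n) (E : List (Label n)) where

  private instance
    4^n-nonZero′ : NonZero (4 ^ n)
    4^n-nonZero′ = 4^n-nonZero n

  gStep-act : ∀ (p : Vertex (4 ^ n) 3) e →
              gStep (act σ E) (permute ρ p) (actLabel ρ e) ≡ Maybe.map (actLabel (blockPerm ρ σ)) (gStep E p e)
  gStep-act p (c , true)
    rewrite lookup-permute ρ p c | labelAt-act σ E (toℕ (lookup p c)) with labelAt E (toℕ (lookup p c))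
  ... | just (l , d) = cong (λ x → just (x , d)) (sym (blockPerm-combine ρ σ c l))
  ... | nothing      = refl
  gStep-act p (c , false)
    rewrite lookup-permute ρ p c | labelAt-act σ E (toℕ (predMod (lookup p c))) with labelAt E (toℕ (predMod (lookup p c)))
  ... | just (l , d) = cong (λ x → just (x , not d)) (sym (blockPerm-combine ρ σ c l))
  ... | nothing      = refl

  gFrom-act : ∀ (p : Vertex (4 ^ n) 3) H → gFrom (act σ E) (permute ρ p) (act ρ H) ≡ act (blockPerm ρ σ) (gFrom E p H)
  gFrom-act p []       = refl
  gFrom-act p (e ∷ es)
    with gStep (act σ E) (permute ρ p) (actLabel ρ e) | gStep E p e | gStep-act p e
       | trans (cong (λ v → gFrom (act σ E) v (act ρ es)) (step-permute ρ e p)) (gFrom-act (step e p) es)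
  ... | just _  | just e′ | refl | tail≡ = cong (actLabel (blockPerm ρ σ) e′ ∷_) tail≡
  ... | nothing | nothing | refl | tail≡ = tail≡

  g-act : ∀ H → g n (act σ E) (act ρ H) ≡ act (blockPerm ρ σ) (g n E H)
  g-act H = trans (cong (λ v → gFrom (act σ E) v (act ρ H)) (sym (permute-replicate ρ (0 mod 4 ^ n))))
                  (gFrom-act (origin (4 ^ n) 3) H)

module _ {n} (ρ : Fin 3 → Permutation′ 3) (σ : Fin n → Permutation′ n) (E₀ : List (Label n)) (H₀ : List (Label 3)) where

  act-productFamily : ∀ b a → act (productFamily ρ σ (combine b a)) (g n E₀ H₀) ≡ g n (act (σ a) E₀) (act (ρ b) H₀)
  act-productFamily b a =
    trans (cong (λ τ → act τ (g n E₀ H₀)) (productFamily-combine ρ σ b a)) (sym (g-act (ρ b) (σ a) E₀ H₀))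

  gFamily⊆orbit : ∀ {E H} → (∀ i → ∃ λ a → E i ≡ act (σ a) E₀) → (∀ j → ∃ λ b → H j ≡ act (ρ b) H₀) →
                  ∀ y → ∃ λ y′ → gFamily n E H y ≡ act (productFamily ρ σ y′) (g n E₀ H₀)
  gFamily⊆orbit {E} {H} E⊆ H⊆ y with combine-surjective {3} {n} y
  ... | j , i , refl with E⊆ i | H⊆ j
  ... | a , Ei≡ | b , Hj≡ =
    combine b a , trans (gFamily-combine n E H j i) (trans (cong₂ (g n) Ei≡ Hj≡) (sym (act-productFamily b a)))

  orbit⊆gFamily : ∀ {E H} → (∀ a → ∃ λ i → act (σ a) E₀ ≡ E i) → (∀ b → ∃ λ j → act (ρ b) H₀ ≡ H j) →
                  ∀ y′ → ∃ λ y → act (productFamily ρ σ y′) (g n E₀ H₀) ≡ gFamily n E H y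
  orbit⊆gFamily {E} {H} ⊆E ⊆H y′ with combine-surjective {3} {n} y′
  ... | b , a , refl with ⊆E a | ⊆H b
  ... | i , ≡Ei | j , ≡Hj =
    combine j i , trans (act-productFamily b a) (trans (cong₂ (g n) ≡Ei ≡Hj) (sym (gFamily-combine n E H j i)))

3≤4^n : ∀ n → 1 ≤ n → 3 ≤ 4 ^ n
3≤4^n n 1≤n = ≤-trans (s≤s (s≤s (s≤s z≤n))) (^-monoʳ-≤ 4 1≤n)

theorem3 : (n : ℕ) → 1 ≤ n →
    (H : Fin 3 → List (Label 3)) → IsLatinHD-G n 3 H →
    (E : Fin n → List (Label n)) → IsLatinHD 4 n E →
    IsLatinHD 4 (3 * n) (gFamily n E H)
theorem3 n 1≤n H (hdH , H₀ , ρ , hamH₀ , latinρ , H⊆ , ⊆H) E (hdE , E₀ , σ , hamE₀ , latinσ , E⊆ , ⊆E) =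
  Decomposition.isHD-gFamily (3≤4^n n 1≤n) H hdH E hdE ,
  g n E₀ H₀ , productFamily ρ σ ,
  Lift.isHamCycle-g E₀ hamE₀ H₀ hamH₀ ,
  isLatinFamily-product {ρ = ρ} {σ} latinρ latinσ ,
  gFamily⊆orbit ρ σ E₀ H₀ E⊆ H⊆ ,
  orbit⊆gFamily ρ σ E₀ H₀ ⊆E ⊆H
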